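{- Let $CT$ be a caterpillar of length $k\ge 1$ with no pair of adjacent trunks. If every stem of $CT$ has at least three pendent neighbours, then $\beta_b(CT)=\lambda(CT)+\tau(CT)$, where $\lambda(CT)$ is the number of leaves and $\tau(CT)$ the number of trunks of $CT$.
   Context: A broadcast on a graph $G$ is a map $f:V(G)\to\mathbb{N}$ with $f(v)\le e_G(v)$ (eccentricity) for every $v$; its cost is $\sum_v f(v)$. It is independent if $d_G(u,v)>\max\{f(u),f(v)\}$ for all distinct $u,v$. $\beta_b(G)$ is the maximum cost of an independent broadcast on $G$. A caterpillar of length $k\ge1$ is a tree whose non-leaf vertices form a path $v_0\dots v_k$ (the spine), with $v_0,v_k$ each adjacent to at least one leaf. A stem is a spine vertex adjacent to at least one leaf (its pendent neighbours); a trunk is a spine vertex $v_i$, $1\le i\le k-1$, adjacent to no leaf. Two trunks are adjacent if they are consecutive spine vertices. -}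

module Defs where

open import Data.Nat using (ℕ; zero; suc; _+_; _≤_; _<_; _⊔_)
open import Data.Fin using (Fin; toℕ; fromℕ; inject₁)
import Data.Fin as F
open import Data.Product using (Σ; _×_; ∃)
open import Relation.Binary.PropositionalEquality using (_≡_; _≢_)
open import Relation.Nullary using (¬_; Dec; does)
open import Relation.Nullary.Decidable using (_×-dec_)
open import Data.Nat using (_≤?_; _≟_)
open import Data.Bool using (if_then_else_)

record Graph : Set₁ where
  field
    V   : Set
    Adj : V → V → Set

module _ (G : Graph) where
  open Graph G

  data Walk : V → V → ℕ → Set where
    here : ∀ {u} → Walk u u 0
    step : ∀ {u w v n} → Adj u w → Walk w v n → Walk u v (suc n)

  IsDist : V → V → ℕ → Set
  IsDist u v d = Walk u v d × (∀ m → Walk u v m → d ≤ m)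

  IsEcc : V → ℕ → Set
  IsEcc v e = (∀ u d → IsDist v u d → d ≤ e) × Σ V (λ u → IsDist v u e)

  IsBroadcast : (V → ℕ) → Set
  IsBroadcast f = ∀ v e → IsEcc v e → f v ≤ e

  IsIndependent : (V → ℕ) → Set
  IsIndependent f = ∀ u v → u ≢ v → 0 < f u → 0 < f v →
                    ∀ d → IsDist u v d → f u ⊔ f v < d

  IsIndepBroadcast : (V → ℕ) → Set
  IsIndepBroadcast f = IsBroadcast f × IsIndependent f

sumFin : (n : ℕ) → (Fin n → ℕ) → ℕ
sumFin zero    g = 0
sumFin (suc n) g = g F.zero + sumFin n (λ i → g (F.suc i))

-- Caterpillars.  A caterpillar of length k is given (up to isomorphism)
-- by its spine v_0 … v_k and the number ℓ i of leaves pendent at v_i.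

data CatV (k : ℕ) (ℓ : Fin (suc k) → ℕ) : Set where
  spine : Fin (suc k) → CatV k ℓ
  leaf  : (i : Fin (suc k)) → Fin (ℓ i) → CatV k ℓ

data CatAdj (k : ℕ) (ℓ : Fin (suc k) → ℕ) : CatV k ℓ → CatV k ℓ → Set where
  spine-fwd  : ∀ i j → toℕ j ≡ suc (toℕ i) → CatAdj k ℓ (spine i) (spine j)
  spine-bwd  : ∀ i j → toℕ i ≡ suc (toℕ j) → CatAdj k ℓ (spine i) (spine j)
  spine-leaf : ∀ i j → CatAdj k ℓ (spine i) (leaf i j)
  leaf-spine : ∀ i j → CatAdj k ℓ (leaf i j) (spine i)

Caterpillar : (k : ℕ) → (Fin (suc k) → ℕ) → Graph
Caterpillar k ℓ = record { V = CatV k ℓ ; Adj = CatAdj k ℓ }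

cost : (k : ℕ) (ℓ : Fin (suc k) → ℕ) → (CatV k ℓ → ℕ) → ℕ
cost k ℓ f = sumFin (suc k) (λ i → f (spine i) + sumFin (ℓ i) (λ j → f (leaf i j)))

IsBroadcastIndependenceNumber : (k : ℕ) (ℓ : Fin (suc k) → ℕ) → ℕ → Set
IsBroadcastIndependenceNumber k ℓ m =
  Σ (CatV k ℓ → ℕ) (λ f → IsIndepBroadcast (Caterpillar k ℓ) f × cost k ℓ f ≡ m)
  × (∀ f → IsIndepBroadcast (Caterpillar k ℓ) f → cost k ℓ f ≤ m)

IsStem : (k : ℕ) (ℓ : Fin (suc k) → ℕ) → Fin (suc k) → Set
IsStem k ℓ i = 1 ≤ ℓ i

IsTrunk : (k : ℕ) (ℓ : Fin (suc k) → ℕ) → Fin (suc k) → Set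
IsTrunk k ℓ i = 1 ≤ toℕ i × toℕ i < k × ℓ i ≡ 0

isTrunk? : (k : ℕ) (ℓ : Fin (suc k) → ℕ) → (i : Fin (suc k)) → Dec (IsTrunk k ℓ i)
isTrunk? k ℓ i = (1 ≤? toℕ i) ×-dec ((suc (toℕ i) ≤? k) ×-dec (ℓ i ≟ 0))

trunkInd : (k : ℕ) (ℓ : Fin (suc k) → ℕ) → Fin (suc k) → ℕ
trunkInd k ℓ i = if does (isTrunk? k ℓ i) then 1 else 0

numLeaves : (k : ℕ) (ℓ : Fin (suc k) → ℕ) → ℕ
numLeaves k ℓ = sumFin (suc k) ℓ

numTrunks : (k : ℕ) (ℓ : Fin (suc k) → ℕ) → ℕ
numTrunks k ℓ = sumFin (suc k) (trunkInd k ℓ)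

NoAdjacentTrunks : (k : ℕ) (ℓ : Fin (suc k) → ℕ) → Set
NoAdjacentTrunks k ℓ = ∀ (i : Fin k) → ¬ (IsTrunk k ℓ (inject₁ i) × IsTrunk k ℓ (F.suc i))

module Submission where

-- Broadcasting with strength 1 from every leaf and every trunk is independent, since
-- no trunk carries a leaf and no two trunks are adjacent; it costs λ + τ.
-- Conversely, weigh spine position i by w(i) = ℓ(i) + [i is a trunk], so that the
-- weights add up to λ + τ.  Every weight is positive, stems weigh at least 3, and a
-- weight ≤ 2 is followed by a weight ≥ 3, so r consecutive positions weigh at least
-- 2r − 1.  A vertex v with f(v) = r + dep(v) (dep = 1 on leaves, 0 on the spine)
-- reaches the leaves at r consecutive positions on the side of its farther end, and
-- independence makes these zones of distinct vertices disjoint on each side.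
-- Charging v the weight of that zone plus the weight of its own position on the
-- other side pays 2 f(v), while each position is charged at most twice its weight
-- (a leaf broadcasting with strength 1 is charged one unit at its own position).
-- Hence 2 cost(f) ≤ 2 (λ + τ).

open import Defs
open import Data.Nat using (ℕ; zero; suc; _+_; _∸_; _≤_; _<_; _⊔_; z≤n; s≤s; s≤s⁻¹; ∣_-_∣; _≤?_; _≟_)
open import Data.Nat.Properties
open import Data.Fin using (Fin; toℕ; fromℕ; fromℕ<; inject₁)
import Data.Fin as F
import Data.Fin.Properties as FP
open import Data.Bool using (if_then_else_)
open import Data.Product using (Σ; _×_; _,_; proj₁; proj₂)
open import Data.Sum using (_⊎_; inj₁; inj₂)
open import Data.Empty using (⊥; ⊥-elim)
open import Relation.Nullary using (¬_; Dec; yes; no; does)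
open import Relation.Nullary.Decidable using (_×-dec_; _⊎-dec_)
open import Relation.Binary.PropositionalEquality
open import Function using (_∘_)
open import Data.Nat.Tactic.RingSolver using (solve-∀)
import Algebra.Properties.CommutativeMonoid.Sum +-0-commutativeMonoid as Sum
open import Algebra.Properties.CommutativeSemigroup +-commutativeSemigroup using (interchange; x∙yz≈y∙xz; xy∙z≈xz∙y)

sumFin≡sum : ∀ n (g : Fin n → ℕ) → sumFin n g ≡ Sum.sum g
sumFin≡sum zero    g = refl
sumFin≡sum (suc n) g = cong (g F.zero +_) (sumFin≡sum n (λ i → g (F.suc i)))

sumFin-+ : ∀ n (g h : Fin n → ℕ) → sumFin n (λ i → g i + h i) ≡ sumFin n g + sumFin n h
sumFin-+ n g h = begin
  sumFin n (λ i → g i + h i) ≡⟨ sumFin≡sum n _ ⟩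
  Sum.sum (λ i → g i + h i)  ≡⟨ Sum.∑-distrib-+ g h ⟩
  Sum.sum g + Sum.sum h      ≡⟨ sym (cong₂ _+_ (sumFin≡sum n g) (sumFin≡sum n h)) ⟩
  sumFin n g + sumFin n h    ∎
  where open ≡-Reasoning

sumFin-comm : ∀ m n (h : Fin m → Fin n → ℕ) →
  sumFin m (λ i → sumFin n (h i)) ≡ sumFin n (λ j → sumFin m (λ i → h i j))
sumFin-comm m n h = begin
  sumFin m (λ i → sumFin n (h i))              ≡⟨ sumFin≡sum m _ ⟩
  Sum.sum (λ i → sumFin n (h i))               ≡⟨ Sum.sum-cong-≗ (λ i → sumFin≡sum n (h i)) ⟩
  Sum.sum (λ i → Sum.sum (h i))                ≡⟨ Sum.∑-comm h ⟩
  Sum.sum (λ j → Sum.sum (λ i → h i j))        ≡⟨ Sum.sum-cong-≗ (λ j → sym (sumFin≡sum m (λ i → h i j))) ⟩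
  Sum.sum (λ j → sumFin m (λ i → h i j))       ≡⟨ sym (sumFin≡sum n _) ⟩
  sumFin n (λ j → sumFin m (λ i → h i j))      ∎
  where open ≡-Reasoning

sumFin-cong : ∀ n {g h : Fin n → ℕ} → (∀ i → g i ≡ h i) → sumFin n g ≡ sumFin n h
sumFin-cong zero    e = refl
sumFin-cong (suc n) e = cong₂ _+_ (e F.zero) (sumFin-cong n (λ i → e (F.suc i)))

sumFin-mono : ∀ n {g h : Fin n → ℕ} → (∀ i → g i ≤ h i) → sumFin n g ≤ sumFin n h
sumFin-mono zero    le = z≤n
sumFin-mono (suc n) le = +-mono-≤ (le F.zero) (sumFin-mono n (λ i → le (F.suc i)))

sumFin-zero : ∀ n {g : Fin n → ℕ} → (∀ i → g i ≡ 0) → sumFin n g ≡ 0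
sumFin-zero zero    e = refl
sumFin-zero (suc n) e = cong₂ _+_ (e F.zero) (sumFin-zero n (λ i → e (F.suc i)))

sumFin-one : ∀ n → sumFin n (λ _ → 1) ≡ n
sumFin-one zero    = refl
sumFin-one (suc n) = cong suc (sumFin-one n)

sumFin-single : ∀ n {g : Fin n → ℕ} i₀ → (∀ i → i ≢ i₀ → g i ≡ 0) → sumFin n g ≡ g i₀
sumFin-single (suc n) {g} F.zero e = trans (cong (g F.zero +_) (sumFin-zero n (λ i → e (F.suc i) (λ ())))) (+-identityʳ _)
sumFin-single (suc n) (F.suc i₀) e = cong₂ _+_ (e F.zero (λ ()))
  (sumFin-single n i₀ (λ i i≢i₀ → e (F.suc i) (i≢i₀ ∘ FP.suc-injective)))

sumFin-term : ∀ n (g : Fin n → ℕ) i → g i ≤ sumFin n g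
sumFin-term (suc n) g F.zero    = m≤m+n _ _
sumFin-term (suc n) g (F.suc i) = ≤-trans (sumFin-term n (λ i → g (F.suc i)) i) (m≤n+m _ _)

ifYes : {A : Set} → Dec A → ℕ → ℕ
ifYes d n = if does d then n else 0

ifYes-yes : {A : Set} (d : Dec A) (n : ℕ) → A → ifYes d n ≡ n
ifYes-yes (yes _) n _ = refl
ifYes-yes (no ¬a) n a = ⊥-elim (¬a a)

ifYes-no : {A : Set} (d : Dec A) (n : ℕ) → ¬ A → ifYes d n ≡ 0
ifYes-no (yes a) n ¬a = ⊥-elim (¬a a)
ifYes-no (no _)  n _  = refl

ifYes-≤ : {A : Set} (d : Dec A) (n : ℕ) → ifYes d n ≤ n
ifYes-≤ (yes _) n = ≤-refl
ifYes-≤ (no _)  n = z≤n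

ifYes>0 : {A : Set} (d : Dec A) {n : ℕ} → 0 < ifYes d n → A
ifYes>0 (yes a) _ = a

intervalSum : ℕ → ℕ → (ℕ → ℕ) → ℕ
intervalSum a zero    g = 0
intervalSum a (suc m) g = g a + intervalSum (suc a) m g

sumFin-toℕ : ∀ n a (g : ℕ → ℕ) → sumFin n (λ j → g (a + toℕ j)) ≡ intervalSum a n g
sumFin-toℕ zero    a g = refl
sumFin-toℕ (suc n) a g = cong₂ _+_ (cong g (+-identityʳ a))
  (trans (sumFin-cong n (λ j → cong g (+-suc a (toℕ j)))) (sumFin-toℕ n (suc a) g))

intervalSum-++ : ∀ a m n g → intervalSum a (m + n) g ≡ intervalSum a m g + intervalSum (a + m) n g
intervalSum-++ a zero    n g = cong (λ x → intervalSum x n g) (sym (+-identityʳ a))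
intervalSum-++ a (suc m) n g = begin
  g a + intervalSum (suc a) (m + n) g                               ≡⟨ cong (g a +_) (intervalSum-++ (suc a) m n g) ⟩
  g a + (intervalSum (suc a) m g + intervalSum (suc a + m) n g)     ≡⟨ sym (+-assoc (g a) _ _) ⟩
  g a + intervalSum (suc a) m g + intervalSum (suc a + m) n g       ≡⟨ cong (λ x → g a + intervalSum (suc a) m g + intervalSum x n g) (sym (+-suc a m)) ⟩
  g a + intervalSum (suc a) m g + intervalSum (a + suc m) n g       ∎
  where open ≡-Reasoning

intervalSum-⊆ : ∀ a m n g → a + m ≤ n → intervalSum a m g ≤ intervalSum 0 n g
intervalSum-⊆ a m n g a+m≤n = begin
  intervalSum a m g                                            ≤⟨ m≤n+m _ _ ⟩
  intervalSum 0 a g + intervalSum a m g                        ≤⟨ m≤m+n _ _ ⟩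
  intervalSum 0 a g + intervalSum a m g + intervalSum (a + m) (n ∸ (a + m)) g
    ≡⟨ cong (_+ intervalSum (a + m) (n ∸ (a + m)) g) (sym (intervalSum-++ 0 a m g)) ⟩
  intervalSum 0 (a + m) g + intervalSum (a + m) (n ∸ (a + m)) g ≡⟨ sym (intervalSum-++ 0 (a + m) _ g) ⟩
  intervalSum 0 (a + m + (n ∸ (a + m))) g                      ≡⟨ cong (λ x → intervalSum 0 x g) (m+[n∸m]≡n a+m≤n) ⟩
  intervalSum 0 n g                                            ∎
  where open ≤-Reasoning

intervalSum-cong : ∀ a m {g h : ℕ → ℕ} → (∀ t → t < m → g (a + t) ≡ h (a + t)) →
  intervalSum a m g ≡ intervalSum a m h
intervalSum-cong a zero    e = refl
intervalSum-cong a (suc m) {g} {h} e = cong₂ _+_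
  (subst (λ x → g x ≡ h x) (+-identityʳ a) (e 0 (s≤s z≤n)))
  (intervalSum-cong (suc a) m (λ t t<m → subst (λ x → g x ≡ h x) (+-suc a t) (e (suc t) (s≤s t<m))))

intervalSum≤sumFin-ifYes : ∀ n (g : ℕ → ℕ) {Q : ℕ → Set} (Q? : ∀ x → Dec (Q x)) a m →
  a + m ≤ n → (∀ t → t < m → Q (a + t)) →
  intervalSum a m g ≤ sumFin n (λ j → ifYes (Q? (toℕ j)) (g (toℕ j)))
intervalSum≤sumFin-ifYes n g Q? a m a+m≤n inQ = begin
  intervalSum a m g       ≡⟨ intervalSum-cong a m (λ t t<m → sym (ifYes-yes (Q? (a + t)) _ (inQ t t<m))) ⟩
  intervalSum a m gQ      ≤⟨ intervalSum-⊆ a m n gQ a+m≤n ⟩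
  intervalSum 0 n gQ      ≡⟨ sym (sumFin-toℕ n 0 gQ) ⟩
  sumFin n (λ j → gQ (toℕ j)) ∎
  where
  open ≤-Reasoning
  gQ : ℕ → ℕ
  gQ x = ifYes (Q? x) (g x)

module _ (n : ℕ) (w : ℕ → ℕ) (w-pos : ∀ j → j < n → 1 ≤ w j)
         (light⇒next-heavy : ∀ j → suc j < n → w j ≤ 2 → 3 ≤ w (suc j)) where

  intervalSum-lower : ∀ m a → a + m ≤ n → m + m ≤ intervalSum a m w + 1
  intervalSum-lower zero    a _ = z≤n
  intervalSum-lower (suc m) a a+m≤n with 3 ≤? w a
  ... | yes heavy = begin
    suc m + suc m                       ≡⟨ cong suc (+-suc m m) ⟩
    2 + (m + m)                         ≤⟨ +-monoʳ-≤ 2 (intervalSum-lower m (suc a) (subst (_≤ n) (+-suc a m) a+m≤n)) ⟩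
    2 + (intervalSum (suc a) m w + 1)   ≤⟨ +-monoˡ-≤ _ (≤-trans (n≤1+n 2) heavy) ⟩
    w a + (intervalSum (suc a) m w + 1) ≡⟨ sym (+-assoc (w a) _ 1) ⟩
    w a + intervalSum (suc a) m w + 1   ∎
    where open ≤-Reasoning
  intervalSum-lower (suc zero) a a+1≤n | no _ =
    +-monoˡ-≤ 1 (≤-trans (w-pos a (subst (_≤ n) (+-comm a 1) a+1≤n)) (m≤m+n _ _))
  intervalSum-lower (suc (suc m)) a a+m≤n | no light = begin
    suc (suc m) + suc (suc m)             ≡⟨ cong (2 +_) (trans (+-suc m (suc m)) (cong suc (+-suc m m))) ⟩
    4 + (m + m)                           ≤⟨ +-monoʳ-≤ 4 (intervalSum-lower m (2 + a) a+2+m≤n) ⟩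
    1 + 3 + (rest + 1)                    ≤⟨ +-monoˡ-≤ _ (+-mono-≤ (w-pos a a<n) (light⇒next-heavy a a+1<n (s≤s⁻¹ (≰⇒> light)))) ⟩
    w a + w (suc a) + (rest + 1)          ≡⟨ +-assoc (w a) _ _ ⟩
    w a + (w (suc a) + (rest + 1))        ≡⟨ cong (w a +_) (sym (+-assoc (w (suc a)) _ 1)) ⟩
    w a + (w (suc a) + rest + 1)          ≡⟨ sym (+-assoc (w a) _ 1) ⟩
    w a + (w (suc a) + rest) + 1          ∎
    where
    open ≤-Reasoning
    rest : ℕ
    rest = intervalSum (2 + a) m w
    a+2+m≤n : 2 + a + m ≤ n
    a+2+m≤n = subst (_≤ n) (trans (+-suc a (suc m)) (cong suc (+-suc a m))) a+m≤n
    a+1<n : suc a < n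
    a+1<n = ≤-trans (s≤s (s≤s (m≤m+n a m))) a+2+m≤n
    a<n : a < n
    a<n = ≤-trans (n≤1+n _) a+1<n

∣n-1+n∣≡1 : ∀ n → ∣ n - suc n ∣ ≡ 1
∣n-1+n∣≡1 zero    = refl
∣n-1+n∣≡1 (suc n) = ∣n-1+n∣≡1 n

a+[∣a-b∣+c]≡b+c : ∀ {a b} c → a ≤ b → a + (∣ a - b ∣ + c) ≡ b + c
a+[∣a-b∣+c]≡b+c {a} {b} c a≤b = begin
  a + (∣ a - b ∣ + c) ≡⟨ cong (λ x → a + (x + c)) (m≤n⇒∣m-n∣≡n∸m a≤b) ⟩
  a + (b ∸ a + c)     ≡⟨ sym (+-assoc a _ c) ⟩
  a + (b ∸ a) + c     ≡⟨ cong (_+ c) (m+[n∸m]≡n a≤b) ⟩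
  b + c               ∎
  where open ≡-Reasoning

2≤∣m-n∣ : ∀ m n → m ≢ n → suc m ≢ n → suc n ≢ m → 2 ≤ ∣ m - n ∣
2≤∣m-n∣ zero          zero          m≢n _ _ = ⊥-elim (m≢n refl)
2≤∣m-n∣ zero          (suc zero)    _ 1≢n _ = ⊥-elim (1≢n refl)
2≤∣m-n∣ zero          (suc (suc n)) _ _ _   = s≤s (s≤s z≤n)
2≤∣m-n∣ (suc zero)    zero          _ _ 1≢m = ⊥-elim (1≢m refl)
2≤∣m-n∣ (suc (suc m)) zero          _ _ _   = s≤s (s≤s z≤n)
2≤∣m-n∣ (suc m)       (suc n)       m≢n 1+m≢n 1+n≢m =
  2≤∣m-n∣ m n (m≢n ∘ cong suc) (1+m≢n ∘ cong suc) (1+n≢m ∘ cong suc)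

module OnCaterpillar (k : ℕ) (ℓ : Fin (suc k) → ℕ) where

  G : Graph
  G = Caterpillar k ℓ

  V : Set
  V = CatV k ℓ

  base : V → Fin (suc k)
  base (spine i)  = i
  base (leaf i _) = i

  pos : V → ℕ
  pos v = toℕ (base v)

  dep : V → ℕ
  dep (spine _)  = 0
  dep (leaf _ _) = 1

  dep≤1 : ∀ v → dep v ≤ 1
  dep≤1 (spine _)  = z≤n
  dep≤1 (leaf _ _) = s≤s z≤n

  pos≤k : ∀ v → pos v ≤ k
  pos≤k v = s≤s⁻¹ (FP.toℕ<n (base v))

  -- the distance between distinct vertices; D v v = 2 for a leaf v
  D : V → V → ℕ
  D u v = ∣ pos u - pos v ∣ + (dep u + dep v)

  _≟V_ : (u v : V) → Dec (u ≡ v)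
  spine i ≟V spine j with i FP.≟ j
  ... | yes refl = yes refl
  ... | no i≢j   = no λ { refl → i≢j refl }
  spine _ ≟V leaf _ _ = no λ ()
  leaf _ _ ≟V spine _ = no λ ()
  leaf i a ≟V leaf j b with i FP.≟ j
  ... | no i≢j   = no λ { refl → i≢j refl }
  ... | yes refl with a FP.≟ b
  ... | yes refl = yes refl
  ... | no a≢b   = no λ { refl → a≢b refl }

  CatAdj-sym : ∀ {u w} → CatAdj k ℓ u w → CatAdj k ℓ w u
  CatAdj-sym (spine-fwd i j e) = spine-bwd j i e
  CatAdj-sym (spine-bwd i j e) = spine-fwd j i e
  CatAdj-sym (spine-leaf i a)  = leaf-spine i a
  CatAdj-sym (leaf-spine i a)  = spine-leaf i a

  _++ʷ_ : ∀ {u w v m n} → Walk G u w m → Walk G w v n → Walk G u v (m + n)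
  here       ++ʷ q = q
  step a p ++ʷ q = step a (p ++ʷ q)

  reverseʷ : ∀ {u v n} → Walk G u v n → Walk G v u n
  reverseʷ here       = here
  reverseʷ (step a p) = subst (Walk G _ _) (+-comm _ 1) (reverseʷ p ++ʷ step (CatAdj-sym a) here)

  spineWalk-up : ∀ n (i j : Fin (suc k)) → toℕ j ≡ toℕ i + n → Walk G (spine i) (spine j) n
  spineWalk-up zero i j j≡i+0 with FP.toℕ-injective (trans j≡i+0 (+-identityʳ _))
  ... | refl = here
  spineWalk-up (suc n) i j j≡i+1+n = step (spine-fwd i i′ (FP.toℕ-fromℕ< i+1<1+k)) (spineWalk-up n i′ j j≡i′+n)
    where
    i+1<1+k : suc (toℕ i) < suc k
    i+1<1+k = ≤-trans (s≤s (≤-trans (s≤s (m≤m+n (toℕ i) n)) (≤-reflexive (sym (trans j≡i+1+n (+-suc _ n))))))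
                      (FP.toℕ<n j)
    i′ : Fin (suc k)
    i′ = fromℕ< i+1<1+k
    j≡i′+n : toℕ j ≡ toℕ i′ + n
    j≡i′+n = trans j≡i+1+n (trans (+-suc (toℕ i) n) (cong (_+ n) (sym (FP.toℕ-fromℕ< i+1<1+k))))

  spineWalk : ∀ i j → Walk G (spine i) (spine j) ∣ toℕ i - toℕ j ∣
  spineWalk i j with ≤-total (toℕ i) (toℕ j)
  ... | inj₁ i≤j = spineWalk-up _ i j (sym (trans (cong (toℕ i +_) (m≤n⇒∣m-n∣≡n∸m i≤j)) (m+[n∸m]≡n i≤j)))
  ... | inj₂ j≤i = subst (Walk G _ _) (∣-∣-comm (toℕ j) (toℕ i)) (reverseʷ (spineWalk-up _ j i
                     (sym (trans (cong (toℕ j +_) (m≤n⇒∣m-n∣≡n∸m j≤i)) (m+[n∸m]≡n j≤i)))))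

  toBase : ∀ v → Walk G v (spine (base v)) (dep v)
  toBase (spine i)  = here
  toBase (leaf i a) = step (leaf-spine i a) here

  D-walk : ∀ u v → Walk G u v (D u v)
  D-walk u v = subst (Walk G u v) (x∙yz≈y∙xz (dep u) ∣ pos u - pos v ∣ (dep v))
    (toBase u ++ʷ (spineWalk (base u) (base v) ++ʷ reverseʷ (toBase v)))

  D-adjacent : ∀ {u w} → CatAdj k ℓ u w → D u w ≡ 1
  D-adjacent (spine-fwd i j j≡1+i) rewrite j≡1+i = trans (+-identityʳ _) (∣n-1+n∣≡1 (toℕ i))
  D-adjacent (spine-bwd i j i≡1+j) rewrite i≡1+j =
    trans (+-identityʳ _) (trans (∣-∣-comm (suc (toℕ j)) (toℕ j)) (∣n-1+n∣≡1 (toℕ j)))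
  D-adjacent (spine-leaf i _) = cong (_+ 1) (m≡n⇒∣m-n∣≡0 {toℕ i} refl)
  D-adjacent (leaf-spine i _) = cong (_+ 1) (m≡n⇒∣m-n∣≡0 {toℕ i} refl)

  D-step : ∀ {u w} v → CatAdj k ℓ u w → D u v ≤ suc (D w v)
  D-step {u} {w} v u~w = begin
    ∣ pu - pv ∣ + (dep u + dep v)                      ≤⟨ +-monoˡ-≤ _ (∣-∣-triangle pu pw pv) ⟩
    ∣ pu - pw ∣ + ∣ pw - pv ∣ + (dep u + dep v)        ≡⟨ interchange ∣ pu - pw ∣ _ (dep u) (dep v) ⟩
    (∣ pu - pw ∣ + dep u) + (∣ pw - pv ∣ + dep v)      ≤⟨ +-monoˡ-≤ _ u-side ⟩
    suc (dep w + (∣ pw - pv ∣ + dep v))                ≡⟨ cong suc (x∙yz≈y∙xz (dep w) _ (dep v)) ⟩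
    suc (D w v)                                        ∎
    where
    open ≤-Reasoning
    pu pv pw : ℕ
    pu = pos u
    pv = pos v
    pw = pos w
    u-side : ∣ pu - pw ∣ + dep u ≤ suc (dep w)
    u-side = ≤-trans (+-monoʳ-≤ ∣ pu - pw ∣ (m≤m+n (dep u) (dep w)))
                     (≤-trans (≤-reflexive (D-adjacent u~w)) (s≤s z≤n))

  D-≤-walk : ∀ {u v n} → Walk G u v n → u ≢ v → D u v ≤ n
  D-≤-walk here u≢u = ⊥-elim (u≢u refl)
  D-≤-walk {v = v} (step {w = w} u~w p) u≢v with w ≟V v
  ... | yes refl = ≤-trans (≤-reflexive (D-adjacent u~w)) (s≤s z≤n)
  ... | no w≢v   = ≤-trans (D-step v u~w) (s≤s (D-≤-walk p w≢v))

  D-isDist : ∀ {u v} → u ≢ v → IsDist G u v (D u v)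
  D-isDist {u} {v} u≢v = D-walk u v , λ _ p → D-≤-walk p u≢v

  dist≤D : ∀ {u v d} → IsDist G u v d → d ≤ D u v
  dist≤D {u} {v} (_ , minimal) = minimal _ (D-walk u v)

  ∣a-b∣≤a⊔[k∸a] : ∀ a {b} → b ≤ k → ∣ a - b ∣ ≤ a ⊔ (k ∸ a)
  ∣a-b∣≤a⊔[k∸a] a {b} b≤k with ∣m-n∣≡[m∸n]∨[n∸m] a b
  ... | inj₁ ≡a∸b = ≤-trans (≤-reflexive ≡a∸b) (≤-trans (m∸n≤m a b) (m≤m⊔n a _))
  ... | inj₂ ≡b∸a = ≤-trans (≤-reflexive ≡b∸a) (≤-trans (∸-monoˡ-≤ a b≤k) (m≤n⊔m a _))

  module Eccentricity (1≤k : 1 ≤ k) (ℓ₀≥1 : 1 ≤ ℓ F.zero) (ℓₖ≥1 : 1 ≤ ℓ (fromℕ k)) where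

    -- the farthest vertex from v is a leaf at whichever end of the spine is farther
    eccentricity : V → ℕ
    eccentricity v = pos v ⊔ (k ∸ pos v) + (dep v + 1)

    D≤eccentricity : ∀ v u → D v u ≤ eccentricity v
    D≤eccentricity v u = +-mono-≤ (∣a-b∣≤a⊔[k∸a] (pos v) (pos≤k u)) (+-monoʳ-≤ (dep v) (dep≤1 u))

    farthest : ∀ v → Σ V λ u → v ≢ u × D v u ≡ eccentricity v
    farthest v with k ∸ pos v ≤? pos v
    ... | yes k∸p≤p = leaf F.zero (fromℕ< ℓ₀≥1) , v≢u , cong (_+ (dep v + 1)) (trans (∣-∣-identityʳ (pos v)) (sym (m≥n⇒m⊔n≡m k∸p≤p)))
      where
      v≢u : v ≢ leaf F.zero (fromℕ< ℓ₀≥1)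
      v≢u refl = 1+n≰n (≤-trans 1≤k k∸p≤p)
    ... | no k∸p≰p = leaf (fromℕ k) (fromℕ< ℓₖ≥1) , v≢u , cong (_+ (dep v + 1)) (begin
        ∣ pos v - toℕ (fromℕ k) ∣ ≡⟨ cong (∣ pos v -_∣) (FP.toℕ-fromℕ k) ⟩
        ∣ pos v - k ∣            ≡⟨ m≤n⇒∣m-n∣≡n∸m (pos≤k v) ⟩
        k ∸ pos v                ≡⟨ sym (m≤n⇒m⊔n≡n (<⇒≤ (≰⇒> k∸p≰p))) ⟩
        pos v ⊔ (k ∸ pos v)      ∎)
      where
      open ≡-Reasoning
      v≢u : v ≢ leaf (fromℕ k) (fromℕ< ℓₖ≥1)
      v≢u refl = k∸p≰p (subst (λ p → k ∸ p ≤ p) (sym (FP.toℕ-fromℕ k)) (≤-trans (≤-reflexive (n∸n≡0 k)) z≤n))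

    eccentricity-isEcc : ∀ v → IsEcc G v (eccentricity v)
    eccentricity-isEcc v with farthest v
    ... | u , v≢u , Dvu≡e =
      (λ u′ d d-dist → ≤-trans (dist≤D d-dist) (D≤eccentricity v u′)) ,
      (u , subst (IsDist G v u) Dvu≡e (D-isDist v≢u))

  cost-+ : ∀ (F H : V → ℕ) → cost k ℓ (λ v → F v + H v) ≡ cost k ℓ F + cost k ℓ H
  cost-+ F H = trans (sumFin-cong (suc k) λ i →
      trans (cong (F (spine i) + H (spine i) +_) (sumFin-+ (ℓ i) (λ a → F (leaf i a)) (λ a → H (leaf i a))))
            (interchange (F (spine i)) (H (spine i)) (sumFin (ℓ i) (λ a → F (leaf i a))) (sumFin (ℓ i) (λ a → H (leaf i a)))))
    (sumFin-+ (suc k) (λ i → F (spine i) + sumFin (ℓ i) (λ a → F (leaf i a)))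
                      (λ i → H (spine i) + sumFin (ℓ i) (λ a → H (leaf i a))))

  cost-mono : ∀ {F H : V → ℕ} → (∀ v → F v ≤ H v) → cost k ℓ F ≤ cost k ℓ H
  cost-mono F≤H = sumFin-mono (suc k) λ i → +-mono-≤ (F≤H (spine i)) (sumFin-mono (ℓ i) λ a → F≤H (leaf i a))

  cost-comm : ∀ n (H : V → Fin n → ℕ) → cost k ℓ (λ v → sumFin n (H v)) ≡ sumFin n (λ j → cost k ℓ (λ v → H v j))
  cost-comm n H = trans (sumFin-cong (suc k) λ i →
      trans (cong (sumFin n (H (spine i)) +_) (sumFin-comm (ℓ i) n (λ a → H (leaf i a))))
            (sym (sumFin-+ n _ _)))
    (sumFin-comm (suc k) n (λ i j → H (spine i) j + sumFin (ℓ i) (λ a → H (leaf i a) j)))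

  cost-single : ∀ {F : V → ℕ} v₀ → (∀ v → v ≢ v₀ → F v ≡ 0) → cost k ℓ F ≡ F v₀
  cost-single {F} (spine i₀) F≡0 = trans
    (sumFin-single (suc k) i₀ λ i i≢i₀ →
      cong₂ _+_ (F≡0 (spine i) λ { refl → i≢i₀ refl }) (sumFin-zero (ℓ i) λ a → F≡0 (leaf i a) λ ()))
    (trans (cong (F (spine i₀) +_) (sumFin-zero (ℓ i₀) λ a → F≡0 (leaf i₀ a) λ ())) (+-identityʳ _))
  cost-single {F} (leaf i₀ a₀) F≡0 = trans
    (sumFin-single (suc k) i₀ λ i i≢i₀ →
      cong₂ _+_ (F≡0 (spine i) λ ()) (sumFin-zero (ℓ i) λ a → F≡0 (leaf i a) λ { refl → i≢i₀ refl }))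
    (cong₂ _+_ (F≡0 (spine i₀) λ ())
      (sumFin-single (ℓ i₀) a₀ λ a a≢a₀ → F≡0 (leaf i₀ a) λ { refl → a≢a₀ refl }))

  cost-≤-leaves : ∀ {F : V → ℕ} i₀ → (∀ i → F (spine i) ≡ 0) → (∀ i a → i ≢ i₀ → F (leaf i a) ≡ 0) →
                  (∀ a → F (leaf i₀ a) ≤ 1) → cost k ℓ F ≤ ℓ i₀
  cost-≤-leaves {F} i₀ spine≡0 other≡0 ≤1 = begin
    cost k ℓ F                               ≡⟨ sumFin-single (suc k) i₀ (λ i i≢i₀ →
                                                  cong₂ _+_ (spine≡0 i) (sumFin-zero (ℓ i) λ a → other≡0 i a i≢i₀)) ⟩
    F (spine i₀) + sumFin (ℓ i₀) (λ a → F (leaf i₀ a)) ≡⟨ cong (_+ sumFin (ℓ i₀) (λ a → F (leaf i₀ a))) (spine≡0 i₀) ⟩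
    sumFin (ℓ i₀) (λ a → F (leaf i₀ a))       ≤⟨ sumFin-mono (ℓ i₀) ≤1 ⟩
    sumFin (ℓ i₀) (λ _ → 1)                   ≡⟨ sumFin-one (ℓ i₀) ⟩
    ℓ i₀                                      ∎
    where open ≤-Reasoning

  any-vertex? : {P : V → Set} → (∀ v → Dec (P v)) → Dec (Σ V P)
  any-vertex? P? with FP.any? (λ i → P? (spine i) ⊎-dec FP.any? (λ a → P? (leaf i a)))
  ... | yes (i , inj₁ p)       = yes (spine i , p)
  ... | yes (i , inj₂ (a , p)) = yes (leaf i a , p)
  ... | no ∄ = no λ { (spine i , p) → ∄ (i , inj₁ p) ; (leaf i a , p) → ∄ (i , inj₂ (a , p)) }

consecutive-trunks-⊥ : ∀ {k ℓ} → NoAdjacentTrunks k ℓ →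
  ∀ i i′ → toℕ i′ ≡ suc (toℕ i) → IsTrunk k ℓ i → IsTrunk k ℓ i′ → ⊥
consecutive-trunks-⊥ {k} {ℓ} no-adjacent-trunks i i′ i′≡1+i trunk trunk′ =
  no-adjacent-trunks x (subst (IsTrunk k ℓ) (sym inject₁x≡i) trunk , subst (IsTrunk k ℓ) (sym sucx≡i′) trunk′)
  where
  i<k : toℕ i < k
  i<k = proj₁ (proj₂ trunk)
  x : Fin k
  x = fromℕ< i<k
  inject₁x≡i : inject₁ x ≡ i
  inject₁x≡i = FP.toℕ-injective (trans (FP.toℕ-inject₁ x) (FP.toℕ-fromℕ< i<k))
  sucx≡i′ : F.suc x ≡ i′
  sucx≡i′ = FP.toℕ-injective (trans (cong suc (FP.toℕ-fromℕ< i<k)) (sym i′≡1+i))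

module Weights (k : ℕ) (ℓ : Fin (suc k) → ℕ) (ℓ₀≥1 : 1 ≤ ℓ F.zero) (ℓₖ≥1 : 1 ≤ ℓ (fromℕ k))
               (no-adjacent-trunks : NoAdjacentTrunks k ℓ) (stem⇒≥3 : ∀ i → IsStem k ℓ i → 3 ≤ ℓ i) where

  weight : Fin (suc k) → ℕ
  weight i = ℓ i + trunkInd k ℓ i

  weight-sum : sumFin (suc k) weight ≡ numLeaves k ℓ + numTrunks k ℓ
  weight-sum = sumFin-+ (suc k) ℓ (trunkInd k ℓ)

  leafless⇒trunk : ∀ i → ℓ i ≡ 0 → IsTrunk k ℓ i
  leafless⇒trunk i ℓᵢ≡0 = 1≤i i ℓᵢ≡0 , i<k , ℓᵢ≡0
    where
    1≤i : ∀ i → ℓ i ≡ 0 → 1 ≤ toℕ i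
    1≤i F.zero    ℓ₀≡0 = ⊥-elim (1+n≰n (≤-trans ℓ₀≥1 (≤-reflexive ℓ₀≡0)))
    1≤i (F.suc _) _    = s≤s z≤n
    i<k : toℕ i < k
    i<k with m≤n⇒m<n∨m≡n (FP.toℕ≤pred[n] i)
    ... | inj₁ i<k = i<k
    ... | inj₂ i≡k = ⊥-elim (1+n≰n (≤-trans ℓₖ≥1 (≤-reflexive
            (trans (cong ℓ (FP.toℕ-injective (trans (FP.toℕ-fromℕ k) (sym i≡k)))) ℓᵢ≡0))))

  weight≥1 : ∀ i → 1 ≤ weight i
  weight≥1 i with ℓ i ≟ 0
  ... | no ℓᵢ≢0  = ≤-trans (n≢0⇒n>0 ℓᵢ≢0) (m≤m+n _ _)
  ... | yes ℓᵢ≡0 = ≤-trans (≤-reflexive (sym (ifYes-yes (isTrunk? k ℓ i) 1 (leafless⇒trunk i ℓᵢ≡0)))) (m≤n+m _ _)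

  stem⇒weight≥3 : ∀ i → 1 ≤ ℓ i → 3 ≤ weight i
  stem⇒weight≥3 i stem = ≤-trans (stem⇒≥3 i stem) (m≤m+n _ _)

  light⇒next-heavy : ∀ i i′ → toℕ i′ ≡ suc (toℕ i) → weight i ≤ 2 → 3 ≤ weight i′
  light⇒next-heavy i i′ i′≡1+i light with ℓ i ≟ 0 | ℓ i′ ≟ 0
  ... | no ℓᵢ≢0  | _         = ⊥-elim (<⇒≱ (stem⇒weight≥3 i (n≢0⇒n>0 ℓᵢ≢0)) light)
  ... | yes _    | no ℓᵢ′≢0  = stem⇒weight≥3 i′ (n≢0⇒n>0 ℓᵢ′≢0)
  ... | yes ℓᵢ≡0 | yes ℓᵢ′≡0 =
    ⊥-elim (consecutive-trunks-⊥ no-adjacent-trunks i i′ i′≡1+i (leafless⇒trunk i ℓᵢ≡0) (leafless⇒trunk i′ ℓᵢ′≡0))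

  weightℕ : ℕ → ℕ
  weightℕ j with j <? suc k
  ... | yes j<1+k = weight (fromℕ< j<1+k)
  ... | no _      = 0

  weightℕ-fromℕ< : ∀ {j} (j<1+k : j < suc k) → weightℕ j ≡ weight (fromℕ< j<1+k)
  weightℕ-fromℕ< {j} j<1+k with j <? suc k
  ... | yes _   = refl
  ... | no j≮1+k = ⊥-elim (j≮1+k j<1+k)

  weightℕ-toℕ : ∀ i → weightℕ (toℕ i) ≡ weight i
  weightℕ-toℕ i = trans (weightℕ-fromℕ< (FP.toℕ<n i)) (cong weight (FP.fromℕ<-toℕ i _))

  weightℕ≥1 : ∀ j → j < suc k → 1 ≤ weightℕ j
  weightℕ≥1 j j<1+k = subst (1 ≤_) (sym (weightℕ-fromℕ< j<1+k)) (weight≥1 _)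

  weightℕ-light⇒next-heavy : ∀ j → suc j < suc k → weightℕ j ≤ 2 → 3 ≤ weightℕ (suc j)
  weightℕ-light⇒next-heavy j 1+j<1+k light =
    subst (3 ≤_) (sym (weightℕ-fromℕ< 1+j<1+k))
      (light⇒next-heavy (fromℕ< j<1+k) (fromℕ< 1+j<1+k)
        (trans (FP.toℕ-fromℕ< 1+j<1+k) (cong suc (sym (FP.toℕ-fromℕ< j<1+k))))
        (subst (_≤ 2) (weightℕ-fromℕ< j<1+k) light))
    where
    j<1+k : j < suc k
    j<1+k = <-trans (n<1+n j) 1+j<1+k

  weight-run : ∀ m a → a + m ≤ suc k → m + m ≤ intervalSum a m weightℕ + 1
  weight-run = intervalSum-lower (suc k) weightℕ weightℕ≥1 weightℕ-light⇒next-heavy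

positive-reach : ∀ {a b d r} → a ≤ b → b + d < a + r → 0 < r
positive-reach {a} {b} {d} {zero}  a≤b b+d<a+0 =
  ⊥-elim (<⇒≱ b+d<a+0 (≤-trans (≤-reflexive (+-identityʳ a)) (≤-trans a≤b (m≤m+n b d))))
positive-reach {r = suc _} _ _ = s≤s z≤n

room-on-one-side : ∀ {p k r} → p ≤ k → r ≤ suc (p ⊔ (k ∸ p)) → r ≤ suc p ⊎ p + r ≤ suc k
room-on-one-side {p} {k} {r} p≤k r≤ with ≤-total p (k ∸ p)
... | inj₂ k∸p≤p = inj₁ (subst (λ x → r ≤ suc x) (m≥n⇒m⊔n≡m k∸p≤p) r≤)
... | inj₁ p≤k∸p = inj₂ (begin
  p + r                ≤⟨ +-monoʳ-≤ p (subst (λ x → r ≤ suc x) (m≤n⇒m⊔n≡n p≤k∸p) r≤) ⟩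
  p + suc (k ∸ p)      ≡⟨ +-suc p _ ⟩
  suc (p + (k ∸ p))    ≡⟨ cong suc (m+[n∸m]≡n p≤k) ⟩
  suc k                ∎)
  where open ≤-Reasoning

run+own : ∀ {r I w X Y} → r + r ≤ I + 1 → I ≤ X → w ≤ Y → r + r + w ≤ X + Y + 1
run+own {r} {I} {w} {X} {Y} run I≤X w≤Y = begin
  r + r + w    ≤⟨ +-monoˡ-≤ w run ⟩
  I + 1 + w    ≡⟨ xy∙z≈xz∙y I 1 w ⟩
  I + w + 1    ≤⟨ +-monoˡ-≤ 1 (+-mono-≤ I≤X w≤Y) ⟩
  X + Y + 1    ∎
  where open ≤-Reasoning

m+m≤n+n⇒m≤n : ∀ {m n} → m + m ≤ n + n → m ≤ n
m+m≤n+n⇒m≤n {m} {n} m+m≤n+n with m ≤? n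
... | yes m≤n = m≤n
... | no m≰n  = ⊥-elim (<⇒≱ (+-mono-< (≰⇒> m≰n) (≰⇒> m≰n)) m+m≤n+n)

module UpperBound (k : ℕ) (1≤k : 1 ≤ k) (ℓ : Fin (suc k) → ℕ) (ℓ₀≥1 : 1 ≤ ℓ F.zero) (ℓₖ≥1 : 1 ≤ ℓ (fromℕ k))
                  (no-adjacent-trunks : NoAdjacentTrunks k ℓ) (stem⇒≥3 : ∀ i → IsStem k ℓ i → 3 ≤ ℓ i)
                  (f : CatV k ℓ → ℕ) (f-indep : IsIndepBroadcast (Caterpillar k ℓ) f) where

  open OnCaterpillar k ℓ
  open Eccentricity 1≤k ℓ₀≥1 ℓₖ≥1
  open Weights k ℓ ℓ₀≥1 ℓₖ≥1 no-adjacent-trunks stem⇒≥3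

  far-apart : ∀ {u v} → u ≢ v → 0 < f u → 0 < f v → pos u ≤ pos v →
              pos u + (f u ⊔ f v) < pos v + (dep u + dep v)
  far-apart {u} {v} u≢v fu>0 fv>0 pu≤pv =
    subst (pos u + (f u ⊔ f v) <_) (a+[∣a-b∣+c]≡b+c (dep u + dep v) pu≤pv)
      (+-monoʳ-< (pos u) (proj₂ f-indep u v u≢v fu>0 fv>0 (D u v) (D-isDist u≢v)))

  -- The right (left) zone of v consists of the spine positions j ≥ pos v (j ≤ pos v)
  -- from which v still reaches the leaves.  A leaf broadcasting with strength 1 has
  -- empty zones and is accounted for by UnitLeafAt instead.
  RightZone LeftZone UnitLeafAt : V → ℕ → Set
  RightZone v j  = pos v ≤ j × j + dep v < pos v + f v
  LeftZone v j   = j ≤ pos v × pos v + dep v < j + f v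
  UnitLeafAt v j = dep v ≡ 1 × f v ≡ 1 × pos v ≡ j

  rightZone? : ∀ v j → Dec (RightZone v j)
  rightZone? v j = (pos v ≤? j) ×-dec (suc (j + dep v) ≤? pos v + f v)

  leftZone? : ∀ v j → Dec (LeftZone v j)
  leftZone? v j = (j ≤? pos v) ×-dec (suc (pos v + dep v) ≤? j + f v)

  unitLeafAt? : ∀ v j → Dec (UnitLeafAt v j)
  unitLeafAt? v j = (dep v ≟ 1) ×-dec ((f v ≟ 1) ×-dec (pos v ≟ j))

  rightZone⇒broadcasting : ∀ {v j} → RightZone v j → 0 < f v
  rightZone⇒broadcasting (p≤j , j+d<p+f) = positive-reach p≤j j+d<p+f

  leftZone⇒broadcasting : ∀ {v j} → LeftZone v j → 0 < f v
  leftZone⇒broadcasting (j≤p , p+d<j+f) = positive-reach j≤p p+d<j+f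

  unique-by-position : {Z : V → Set} →
    (∀ {u v} → u ≢ v → Z u → Z v → pos u ≤ pos v → ⊥) → ∀ {u v} → Z u → Z v → u ≡ v
  unique-by-position ordered-⊥ {u} {v} zu zv with u ≟V v
  ... | yes u≡v = u≡v
  ... | no u≢v with ≤-total (pos u) (pos v)
  ... | inj₁ pu≤pv = ⊥-elim (ordered-⊥ u≢v zu zv pu≤pv)
  ... | inj₂ pv≤pu = ⊥-elim (ordered-⊥ (u≢v ∘ sym) zv zu pv≤pu)

  rightZone-unique : ∀ {j u v} → RightZone u j → RightZone v j → u ≡ v
  rightZone-unique {j} = unique-by-position λ {u} {v} u≢v zu zv pu≤pv →
    <⇒≱ (far-apart u≢v (rightZone⇒broadcasting zu) (rightZone⇒broadcasting zv) pu≤pv) (begin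
      pos v + (dep u + dep v)   ≤⟨ +-mono-≤ (proj₁ zv) (+-monoʳ-≤ (dep u) (dep≤1 v)) ⟩
      j + (dep u + 1)           ≡⟨ trans (sym (+-assoc j (dep u) 1)) (+-comm _ 1) ⟩
      suc (j + dep u)           ≤⟨ proj₂ zu ⟩
      pos u + f u               ≤⟨ +-monoʳ-≤ (pos u) (m≤m⊔n (f u) (f v)) ⟩
      pos u + (f u ⊔ f v)       ∎)
    where open ≤-Reasoning

  leftZone-unique : ∀ {j u v} → LeftZone u j → LeftZone v j → u ≡ v
  leftZone-unique {j} = unique-by-position λ {u} {v} u≢v zu zv pu≤pv →
    <⇒≱ (far-apart u≢v (leftZone⇒broadcasting zu) (leftZone⇒broadcasting zv) pu≤pv) (begin
      pos v + (dep u + dep v)   ≤⟨ +-monoʳ-≤ (pos v) (+-monoˡ-≤ (dep v) (dep≤1 u)) ⟩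
      pos v + suc (dep v)       ≡⟨ +-suc (pos v) (dep v) ⟩
      suc (pos v + dep v)       ≤⟨ proj₂ zv ⟩
      j + f v                   ≤⟨ +-mono-≤ (proj₁ zu) (m≤n⊔m (f u) (f v)) ⟩
      pos u + (f u ⊔ f v)       ∎)
    where open ≤-Reasoning

  unitLeaf-rightZone-⊥ : ∀ {j u v} → UnitLeafAt u j → RightZone v j → ⊥
  unitLeaf-rightZone-⊥ {j} {u} {v} (d≡1 , f≡1 , p≡j) zv with v ≟V u
  ... | yes refl = 1+n≰n (≤-trans (proj₂ zv) (≤-reflexive (cong₂ _+_ p≡j (trans f≡1 (sym d≡1)))))
  ... | no v≢u = <⇒≱ (far-apart v≢u (rightZone⇒broadcasting zv) (≤-reflexive (sym f≡1))
                       (subst (pos v ≤_) (sym p≡j) (proj₁ zv))) (begin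
      pos u + (dep v + dep u)   ≡⟨ cong₂ (λ p d → p + (dep v + d)) p≡j d≡1 ⟩
      j + (dep v + 1)           ≡⟨ trans (sym (+-assoc j (dep v) 1)) (+-comm _ 1) ⟩
      suc (j + dep v)           ≤⟨ proj₂ zv ⟩
      pos v + f v               ≤⟨ +-monoʳ-≤ (pos v) (m≤m⊔n (f v) (f u)) ⟩
      pos v + (f v ⊔ f u)       ∎)
    where open ≤-Reasoning

  unitLeaf-leftZone-⊥ : ∀ {j u v} → UnitLeafAt u j → LeftZone v j → ⊥
  unitLeaf-leftZone-⊥ {j} {u} {v} (d≡1 , f≡1 , p≡j) zv with u ≟V v
  ... | yes refl = 1+n≰n (≤-trans (proj₂ zv) (≤-reflexive (cong₂ _+_ (sym p≡j) (trans f≡1 (sym d≡1)))))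
  ... | no u≢v = <⇒≱ (far-apart u≢v (≤-reflexive (sym f≡1)) (leftZone⇒broadcasting zv)
                       (subst (_≤ pos v) (sym p≡j) (proj₁ zv))) (begin
      pos v + (dep u + dep v)   ≡⟨ cong (λ d → pos v + (d + dep v)) d≡1 ⟩
      pos v + suc (dep v)       ≡⟨ +-suc (pos v) (dep v) ⟩
      suc (pos v + dep v)       ≤⟨ proj₂ zv ⟩
      j + f v                   ≤⟨ +-mono-≤ (≤-reflexive (sym p≡j)) (m≤n⊔m (f u) (f v)) ⟩
      pos u + (f u ⊔ f v)       ∎)
    where open ≤-Reasoning

  familyCharge : {Z : V → ℕ → Set} → (∀ v j → Dec (Z v j)) → V → Fin (suc k) → ℕ
  familyCharge Z? v i = ifYes (Z? v (toℕ i)) (weight i) + ifYes (unitLeafAt? v (toℕ i)) 1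

  familyCharge-load : {Z : V → ℕ → Set} (Z? : ∀ v j → Dec (Z v j)) →
    (∀ {j u v} → Z u j → Z v j → u ≡ v) → (∀ {j u v} → UnitLeafAt u j → Z v j → ⊥) →
    ∀ i → cost k ℓ (λ v → familyCharge Z? v i) ≤ weight i
  familyCharge-load Z? unique exclusive i with any-vertex? (λ v → Z? v (toℕ i))
  ... | yes (v₀ , z₀) = begin
    cost k ℓ (λ v → familyCharge Z? v i) ≡⟨ cost-single v₀ (λ v v≢v₀ →
                                               cong₂ _+_ (ifYes-no (Z? v _) _ (λ z → v≢v₀ (unique z z₀)))
                                                         (ifYes-no (unitLeafAt? v _) 1 (λ u → exclusive u z₀))) ⟩
    familyCharge Z? v₀ i                  ≡⟨ cong₂ _+_ (ifYes-yes (Z? v₀ _) _ z₀)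
                                                      (ifYes-no (unitLeafAt? v₀ _) 1 (λ u → exclusive u z₀)) ⟩
    weight i + 0                          ≡⟨ +-identityʳ _ ⟩
    weight i                              ∎
    where open ≤-Reasoning
  ... | no ∄ = ≤-trans (cost-≤-leaves {λ v → familyCharge Z? v i} i
      (λ i′ → cong₂ _+_ (no-zone (spine i′)) (ifYes-no (unitLeafAt? (spine i′) (toℕ i)) 1 λ ()))
      (λ i′ a i′≢i → cong₂ _+_ (no-zone (leaf i′ a))
                       (ifYes-no (unitLeafAt? (leaf i′ a) _) 1 λ (_ , _ , i′≡i) → i′≢i (FP.toℕ-injective i′≡i)))
      (λ a → ≤-trans (≤-reflexive (cong (_+ ifYes (unitLeafAt? (leaf i a) (toℕ i)) 1) (no-zone (leaf i a)))) (ifYes-≤ (unitLeafAt? (leaf i a) _) 1)))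
    (m≤m+n (ℓ i) _)
    where
    no-zone : ∀ v → ifYes (Z? v (toℕ i)) (weight i) ≡ 0
    no-zone v = ifYes-no (Z? v (toℕ i)) _ (λ z → ∄ (v , z))

  zoneWeight : {Z : V → ℕ → Set} → (∀ v j → Dec (Z v j)) → V → ℕ
  zoneWeight Z? v = sumFin (suc k) (λ i → ifYes (Z? v (toℕ i)) (weight i))

  interval⊆zone : {Z : V → ℕ → Set} (Z? : ∀ v j → Dec (Z v j)) → ∀ v a m → a + m ≤ suc k →
    (∀ t → t < m → Z v (a + t)) → intervalSum a m weightℕ ≤ zoneWeight Z? v
  interval⊆zone Z? v a m fits inZ = ≤-trans (intervalSum≤sumFin-ifYes (suc k) weightℕ (Z? v) a m fits inZ)
    (≤-reflexive (sumFin-cong (suc k) λ i → cong (ifYes (Z? v (toℕ i))) (weightℕ-toℕ i)))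

  own-position⊆zone : {Z : V → ℕ → Set} (Z? : ∀ v j → Dec (Z v j)) → ∀ v → Z v (pos v) →
    weightℕ (pos v) ≤ zoneWeight Z? v
  own-position⊆zone {Z} Z? v z = ≤-trans (≤-reflexive (sym (+-identityʳ _)))
    (interval⊆zone Z? v (pos v) 1 (subst (_≤ suc k) (+-comm 1 (pos v)) (s≤s (pos≤k v)))
      λ { zero _ → subst (Z v) (sym (+-identityʳ _)) z ; (suc _) (s≤s ()) })

  own-position-in-zones : ∀ v → dep v < f v → RightZone v (pos v) × LeftZone v (pos v)
  own-position-in-zones v d<f = (≤-refl , reach) , (≤-refl , reach)
    where
    reach : pos v + dep v < pos v + f v
    reach = +-monoʳ-< (pos v) d<f

  rightZone-run : ∀ v r → r + dep v ≡ f v → ∀ t → t < r → RightZone v (pos v + t)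
  rightZone-run v r r+d≡f t t<r = m≤m+n _ _ , (begin-strict
    pos v + t + dep v     ≡⟨ +-assoc (pos v) t (dep v) ⟩
    pos v + (t + dep v)   <⟨ +-monoʳ-< (pos v) (+-monoˡ-< (dep v) t<r) ⟩
    pos v + (r + dep v)   ≡⟨ cong (pos v +_) r+d≡f ⟩
    pos v + f v           ∎)
    where open ≤-Reasoning

  leftZone-run : ∀ v r a → a + r ≡ suc (pos v) → r + dep v ≡ f v → ∀ t → t < r → LeftZone v (a + t)
  leftZone-run v r a a+r≡1+p r+d≡f t t<r =
    s≤s⁻¹ (≤-trans (+-monoʳ-< a t<r) (≤-reflexive a+r≡1+p)) , (begin
    suc (pos v + dep v)   ≡⟨ cong (_+ dep v) (sym a+r≡1+p) ⟩
    a + r + dep v         ≡⟨ +-assoc a r (dep v) ⟩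
    a + (r + dep v)       ≡⟨ cong (a +_) r+d≡f ⟩
    a + f v               ≤⟨ +-monoˡ-≤ (f v) (m≤m+n a t) ⟩
    a + t + f v           ∎)
    where open ≤-Reasoning

  reach-room : ∀ v r → r + dep v ≡ f v → r ≤ suc (pos v) ⊎ pos v + r ≤ suc k
  reach-room v r r+d≡f = room-on-one-side (pos≤k v) (+-cancelʳ-≤ (dep v) r _ (begin
    r + dep v                                ≡⟨ r+d≡f ⟩
    f v                                      ≤⟨ proj₁ f-indep v _ (eccentricity-isEcc v) ⟩
    pos v ⊔ (k ∸ pos v) + (dep v + 1)        ≡⟨ trans (cong (pos v ⊔ (k ∸ pos v) +_) (+-comm (dep v) 1)) (+-suc _ (dep v)) ⟩
    suc (pos v ⊔ (k ∸ pos v)) + dep v        ∎))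
    where open ≤-Reasoning

  zones-weigh : ∀ v r → r + dep v ≡ f v → 1 ≤ r →
    r + r + weightℕ (pos v) ≤ zoneWeight rightZone? v + zoneWeight leftZone? v + 1
  zones-weigh v r r+d≡f 1≤r
    with own-position-in-zones v (≤-trans (+-monoˡ-≤ (dep v) 1≤r) (≤-reflexive r+d≡f)) | reach-room v r r+d≡f
  ... | own-right , own-left | inj₂ room-right =
    run+own {r} (weight-run r (pos v) room-right)
            (interval⊆zone rightZone? v (pos v) r room-right (rightZone-run v r r+d≡f))
            (own-position⊆zone leftZone? v own-left)
  ... | own-right , own-left | inj₁ room-left =
    subst (λ x → r + r + weightℕ (pos v) ≤ x + 1) (+-comm _ (zoneWeight rightZone? v))
    (run+own {r} (weight-run r a room)
             (interval⊆zone leftZone? v a r room (leftZone-run v r a a+r≡1+p r+d≡f))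
             (own-position⊆zone rightZone? v own-right))
    where
    a : ℕ
    a = suc (pos v) ∸ r
    a+r≡1+p : a + r ≡ suc (pos v)
    a+r≡1+p = m∸n+n≡m room-left
    room : a + r ≤ suc k
    room = ≤-trans (≤-reflexive a+r≡1+p) (s≤s (pos≤k v))

  zoneWeights : V → ℕ
  zoneWeights v = zoneWeight rightZone? v + zoneWeight leftZone? v

  unitCount : V → ℕ
  unitCount v = sumFin (suc k) (λ i → ifYes (unitLeafAt? v (toℕ i)) 1)

  double-via-zones : ∀ v r {n} → r + dep v ≡ n → f v ≡ n → 1 ≤ r →
    n + n + 1 ≤ r + r + weightℕ (pos v) → n + n ≤ zoneWeights v
  double-via-zones v r r+d≡n f≡n 1≤r key =
    +-cancelʳ-≤ 1 _ _ (≤-trans key (zones-weigh v r (trans r+d≡n (sym f≡n)) 1≤r))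

  double-f≤zones⊎units : ∀ v {n} → f v ≡ n → n + n ≤ zoneWeights v ⊎ n + n ≤ unitCount v + unitCount v
  double-f≤zones⊎units v {zero} _ = inj₁ z≤n
  double-f≤zones⊎units (spine i) {suc r} f≡ = inj₁ (double-via-zones (spine i) (suc r) (+-identityʳ _) f≡ (s≤s z≤n)
    (+-monoʳ-≤ (suc r + suc r) (weightℕ≥1 (toℕ i) (FP.toℕ<n i))))
  double-f≤zones⊎units (leaf i a) {suc zero} f≡ = inj₂ (+-mono-≤ unit unit)
    where
    unit : 1 ≤ unitCount (leaf i a)
    unit = ≤-trans (≤-reflexive (sym (ifYes-yes (unitLeafAt? (leaf i a) (toℕ i)) 1 (refl , f≡ , refl))))
                   (sumFin-term (suc k) (λ i′ → ifYes (unitLeafAt? (leaf i a) (toℕ i′)) 1) i)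
  double-f≤zones⊎units (leaf i a) {suc (suc r)} f≡ = inj₁ (double-via-zones (leaf i a) (suc r) (+-comm (suc r) 1) f≡ (s≤s z≤n)
    (begin
      suc (suc r) + suc (suc r) + 1 ≡⟨ rearrange r ⟩
      suc r + suc r + 3             ≤⟨ +-monoʳ-≤ (suc r + suc r) heavy ⟩
      suc r + suc r + weightℕ (toℕ i) ∎))
    where
    open ≤-Reasoning
    rearrange : ∀ r → suc (suc r) + suc (suc r) + 1 ≡ suc r + suc r + 3
    rearrange = solve-∀
    heavy : 3 ≤ weightℕ (toℕ i)
    heavy = subst (3 ≤_) (sym (weightℕ-toℕ i)) (stem⇒weight≥3 i (≤-trans (s≤s z≤n) (FP.toℕ<n a)))

  charge : V → Fin (suc k) → ℕ
  charge v i = familyCharge rightZone? v i + familyCharge leftZone? v i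

  double-f≤charge : ∀ v → f v + f v ≤ sumFin (suc k) (charge v)
  double-f≤charge v = ≤-trans (either (double-f≤zones⊎units v refl)) (≤-reflexive (sym charge-sum))
    where
    charge-sum : sumFin (suc k) (charge v) ≡ (zoneWeight rightZone? v + unitCount v) + (zoneWeight leftZone? v + unitCount v)
    charge-sum = trans (sumFin-+ (suc k) (familyCharge rightZone? v) (familyCharge leftZone? v))
      (cong₂ _+_ (sumFin-+ (suc k) (λ i → ifYes (rightZone? v (toℕ i)) (weight i)) unit)
                 (sumFin-+ (suc k) (λ i → ifYes (leftZone? v (toℕ i)) (weight i)) unit))
      where
      unit : Fin (suc k) → ℕ
      unit i = ifYes (unitLeafAt? v (toℕ i)) 1
    either : f v + f v ≤ zoneWeights v ⊎ f v + f v ≤ unitCount v + unitCount v →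
             f v + f v ≤ (zoneWeight rightZone? v + unitCount v) + (zoneWeight leftZone? v + unitCount v)
    either (inj₁ ≤zones) = ≤-trans ≤zones (+-mono-≤ (m≤m+n (zoneWeight rightZone? v) (unitCount v))
                                                    (m≤m+n (zoneWeight leftZone? v) (unitCount v)))
    either (inj₂ ≤units) = ≤-trans ≤units (+-mono-≤ (m≤n+m (unitCount v) (zoneWeight rightZone? v))
                                                    (m≤n+m (unitCount v) (zoneWeight leftZone? v)))

  charge-load : ∀ i → cost k ℓ (λ v → charge v i) ≤ weight i + weight i
  charge-load i = ≤-trans (≤-reflexive (cost-+ (λ v → familyCharge rightZone? v i) (λ v → familyCharge leftZone? v i)))
    (+-mono-≤ (familyCharge-load rightZone? rightZone-unique unitLeaf-rightZone-⊥ i)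
              (familyCharge-load leftZone? leftZone-unique unitLeaf-leftZone-⊥ i))

  cost≤leaves+trunks : cost k ℓ f ≤ numLeaves k ℓ + numTrunks k ℓ
  cost≤leaves+trunks = subst (cost k ℓ f ≤_) weight-sum (m+m≤n+n⇒m≤n (begin
    cost k ℓ f + cost k ℓ f                             ≡⟨ sym (cost-+ f f) ⟩
    cost k ℓ (λ v → f v + f v)                          ≤⟨ cost-mono double-f≤charge ⟩
    cost k ℓ (λ v → sumFin (suc k) (charge v))          ≡⟨ cost-comm (suc k) charge ⟩
    sumFin (suc k) (λ i → cost k ℓ (λ v → charge v i))  ≤⟨ sumFin-mono (suc k) charge-load ⟩
    sumFin (suc k) (λ i → weight i + weight i)          ≡⟨ sumFin-+ (suc k) weight weight ⟩
    sumFin (suc k) weight + sumFin (suc k) weight       ∎))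
    where open ≤-Reasoning

module LowerBound (k : ℕ) (ℓ : Fin (suc k) → ℕ) (ℓ₀≥1 : 1 ≤ ℓ F.zero)
                  (no-adjacent-trunks : NoAdjacentTrunks k ℓ) where

  open OnCaterpillar k ℓ

  f★ : V → ℕ
  f★ (spine i)  = trunkInd k ℓ i
  f★ (leaf _ _) = 1

  f★≤1 : ∀ v → f★ v ≤ 1
  f★≤1 (spine i)  = ifYes-≤ (isTrunk? k ℓ i) 1
  f★≤1 (leaf _ _) = ≤-refl

  cost-f★ : cost k ℓ f★ ≡ numLeaves k ℓ + numTrunks k ℓ
  cost-f★ = trans (sumFin-cong (suc k) λ i → cong (trunkInd k ℓ i +_) (sumFin-one (ℓ i)))
                  (trans (sumFin-+ (suc k) (trunkInd k ℓ) ℓ) (+-comm (numTrunks k ℓ) (numLeaves k ℓ)))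

  f★-broadcast : IsBroadcast G f★
  f★-broadcast v e (D≤e , _) = ≤-trans (f★≤1 v) (≤-trans (1≤D v) (D≤e _ _ (D-isDist (v≢other v))))
    where
    other : V → V
    other (spine _)  = leaf F.zero (fromℕ< ℓ₀≥1)
    other (leaf _ _) = spine F.zero
    v≢other : ∀ v → v ≢ other v
    v≢other (spine _) ()
    v≢other (leaf _ _) ()
    1≤D : ∀ v → 1 ≤ D v (other v)
    1≤D (spine i)  = m≤n+m 1 _
    1≤D (leaf i _) = m≤n+m 1 _

  leaf-not-at-trunk : ∀ i (a : Fin (ℓ i)) j → IsTrunk k ℓ j → toℕ i ≢ toℕ j
  leaf-not-at-trunk i a j (_ , _ , ℓⱼ≡0) i≡j with FP.toℕ-injective i≡j
  ... | refl = FP.¬Fin0 (subst Fin ℓⱼ≡0 a)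

  2≤D : ∀ {u v} → u ≢ v → 0 < f★ u → 0 < f★ v → 2 ≤ D u v
  2≤D {leaf i _} {leaf j _} _ _ _ = m≤n+m 2 ∣ toℕ i - toℕ j ∣
  2≤D {leaf i a} {spine j} _ _ trunkⱼ =
    +-mono-≤ (n≢0⇒n>0 (leaf-not-at-trunk i a j (ifYes>0 (isTrunk? k ℓ j) trunkⱼ) ∘ ∣m-n∣≡0⇒m≡n)) (≤-refl {1})
  2≤D {spine i} {leaf j b} _ trunkᵢ _ =
    +-mono-≤ (n≢0⇒n>0 (leaf-not-at-trunk j b i (ifYes>0 (isTrunk? k ℓ i) trunkᵢ) ∘ sym ∘ ∣m-n∣≡0⇒m≡n)) (≤-refl {1})
  2≤D {spine i} {spine j} i≢j trunkᵢ trunkⱼ = ≤-trans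
    (2≤∣m-n∣ (toℕ i) (toℕ j) (i≢j ∘ cong spine ∘ FP.toℕ-injective)
      (λ 1+i≡j → consecutive-trunks-⊥ no-adjacent-trunks i j (sym 1+i≡j) tᵢ tⱼ)
      (λ 1+j≡i → consecutive-trunks-⊥ no-adjacent-trunks j i (sym 1+j≡i) tⱼ tᵢ))
    (m≤m+n _ 0)
    where
    tᵢ : IsTrunk k ℓ i
    tᵢ = ifYes>0 (isTrunk? k ℓ i) trunkᵢ
    tⱼ : IsTrunk k ℓ j
    tⱼ = ifYes>0 (isTrunk? k ℓ j) trunkⱼ

  f★-independent : IsIndependent G f★
  f★-independent u v u≢v f★u>0 f★v>0 d (walk , _) =
    ≤-trans (s≤s (⊔-lub (f★≤1 u) (f★≤1 v))) (≤-trans (2≤D u≢v f★u>0 f★v>0) (D-≤-walk walk u≢v))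

corollary3 : (k : ℕ) → 1 ≤ k → (ℓ : Fin (suc k) → ℕ) →
    1 ≤ ℓ F.zero → 1 ≤ ℓ (fromℕ k) →
    NoAdjacentTrunks k ℓ →
    (∀ i → IsStem k ℓ i → 3 ≤ ℓ i) →
    IsBroadcastIndependenceNumber k ℓ (numLeaves k ℓ + numTrunks k ℓ)
corollary3 k 1≤k ℓ ℓ₀≥1 ℓₖ≥1 no-adjacent-trunks stem⇒≥3 =
  (f★ , (f★-broadcast , f★-independent) , cost-f★) ,
  λ f f-indep → UpperBound.cost≤leaves+trunks k 1≤k ℓ ℓ₀≥1 ℓₖ≥1 no-adjacent-trunks stem⇒≥3 f f-indep
  where open LowerBound k ℓ ℓ₀≥1 no-adjacent-trunks
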